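{- The rewrite relation $\to_{\mathrm{TH}}$ is not confluent: there exist SOP morphisms $t,t',t''$ (indeed with $t\in\mathrm{SOP}[\frac12]$) such that $t$ rewrites to both $t'$ and $t''$ in finitely many $\to_{\mathrm{TH}}$ steps, $t'$ and $t''$ are irreducible for $\to_{\mathrm{TH}}$, and $t'\neq t''$.
   Context: An SOP morphism $t:n\to m$ is a formal expression $t=s\sum_{\vec y\in V^k}e^{2i\pi P(\vec y)}|\vec O(\vec y)\rangle\langle\vec I(\vec y)|$ where $s\in\mathbb R$, $\vec y=(y_1,\dots,y_k)$ are distinct boolean summation variables, the phase polynomial $P$ lies in $\mathbb R[y_1,\dots,y_k]/(y_j^2-y_j)$, $\vec O\in\mathbb F_2[\vec y]^m$, $\vec I\in\mathbb F_2[\vec y]^n$. Morphisms are identified up to renaming of summation variables, and phase polynomials are identified when their difference has integer coefficients. $\mathrm{SOP}[\frac12]$ is the set of such morphisms $\frac{1}{\sqrt2^{\,p}}\sum_{\vec y}e^{2i\pi\frac{P}{2}}|\vec O\rangle\langle\vec I|$ with $p\in\mathbb Z$ and $P$ with integer coefficients. For $Q\in\mathbb F_2[\vec y]$, $\widehat Q$ is the real polynomial defined by $\widehat{Q_1Q_2}=\widehat{Q_1}\widehat{Q_2}$, $\widehat{Q_1\oplus Q_2}=\widehat{Q_1}+\widehat{Q_2}-2\widehat{Q_1}\widehat{Q_2}$, $\widehat{y_j}=y_j$, $\widehat0=0$, $\widehat1=1$. Notation: $\mathrm{Var}(\cdot)$ is the set of variables occurring in a collection of polynomials; $t[y\leftarrow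 Q]$ denotes substitution of $Q$ for $y$ in $\vec O,\vec I$ and of $\widehat Q$ for $y$ in $P$. The rewrite relation $\to_{\mathrm{TH}}$ consists of the following rules, applied to whole morphisms (scalar $s$ carried along unless stated): (Elim) $s\sum_{\vec y}e^{2i\pi P}|\vec O\rangle\langle\vec I|\to 2s\sum_{\vec y\setminus\{y_0\}}e^{2i\pi P}|\vec O\rangle\langle\vec I|$ if $y_0$ is a summation variable not in $\mathrm{Var}(P,\vec O,\vec I)$. (HHgen) $t=s\sum_{\vec y}e^{2i\pi(\frac{y_0}{2}(y_i\widehat Q+\widehat{Q'}+1)+R)}|\vec O\rangle\langle\vec I|\to t[y_i\leftarrow 1\oplus Q']$ (with $y_i$ removed from the summation), provided $y_0\neq y_i$ are summation variables, $QQ'=Q'$, $y_0\notin\mathrm{Var}(Q,Q',R,\vec O,\vec I)$, $y_i\notin\mathrm{Var}(Q,Q')$. (ket) If $O_i=y_0\oplus O_i'$ with $O_i'\neq0$ and $y_0\notin\mathrm{Var}(O_1,\dots,O_{i-1},O_i')$, then $t\to t[y_0\leftarrow O_i]$ ($y_0$ stays a summation variable). (bra) If $I_i=y_0\oplus I_i'$ with $I_i'\neq0$ and $y_0\notin\mathrm{Var}(\vec O,I_1,\dots,I_{i-1},I_i')$, then $t\to t[y_0\leftarrow I_i]$. (Z) $s\sum_{\vec y}e^{2i\pi(\frac{y_0}{2}+R)}|\vec O\rangle\langle\vec I|\to\sum_{y_0}e^{2i\pi\frac{y_0}{2}}|0\cdots0\rangle\langle0\cdots0|$ provided $y_0\notin\mathrm{Var}(R,\vec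 O,\vec I)$ and ($R\neq0$ or $\vec O,\vec I$ not all zero). -}

module Defs where

open import Data.Nat using (ℕ; zero; suc; _<_)
open import Data.Integer using (ℤ; +_; -[1+_])
open import Data.Bool using (Bool; true; false; _∧_; _∨_; _xor_; if_then_else_; not)
import Data.Bool.Properties as BoolP
open import Data.Fin using (Fin; toℕ)
import Data.Fin
open import Data.Vec using (Vec; []; _∷_; lookup; zipWith; replicate; insertAt; _[_]≔_; tabulate)
import Data.Vec as V
open import Data.Vec.Properties using (≡-dec)
open import Data.List using (List; []; _∷_; _++_; map; foldr; concatMap)
open import Data.Rational using (ℚ; 0ℚ; 1ℚ; ½; _+_; _*_; _-_; -_)
import Data.Rational as Q
open import Data.Product using (Σ; _×_; _,_; ∃)
open import Data.Sum using (_⊎_)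
open import Relation.Nullary using (¬_; Dec; yes; no)
open import Relation.Nullary.Decidable using (⌊_⌋)
open import Relation.Binary.PropositionalEquality using (_≡_; _≢_)
open import Function.Bundles using (_↔_; Inverse)

-- Multilinear polynomials in boolean variables y_0 … y_{k-1}
-- (i.e. modulo y_j² = y_j), represented by their coefficient
-- function on monomials.  A monomial is the set of its variables,
-- given as a boolean vector.

Mon : ℕ → Set
Mon k = Vec Bool k

allMon : (k : ℕ) → List (Mon k)
allMon zero    = [] ∷ []
allMon (suc k) = map (false ∷_) (allMon k) ++ map (true ∷_) (allMon k)

_≟m_ : ∀ {k} (a b : Mon k) → Dec (a ≡ b)
_≟m_ = ≡-dec BoolP._≟_

-- product of monomials (y² = y)
_∪m_ : ∀ {k} → Mon k → Mon k → Mon k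
_∪m_ = zipWith _∨_

emptyMon : ∀ {k} → Mon k
emptyMon = replicate _ false

unitMon : ∀ {k} → Fin k → Mon k
unitMon j = emptyMon [ j ]≔ true

Poly2 : ℕ → Set
Poly2 k = Mon k → Bool

-- ℝ[y]/(y_j² - y_j), restricted to rational coefficients
PolyQ : ℕ → Set
PolyQ k = Mon k → ℚ

zero2 : ∀ {k} → Poly2 k
zero2 _ = false

one2 : ∀ {k} → Poly2 k
one2 m = ⌊ m ≟m emptyMon ⌋

var2 : ∀ {k} → Fin k → Poly2 k
var2 j m = ⌊ m ≟m unitMon j ⌋

_⊕_ : ∀ {k} → Poly2 k → Poly2 k → Poly2 k
(f ⊕ g) m = f m xor g m

_·2_ : ∀ {k} → Poly2 k → Poly2 k → Poly2 k
_·2_ {k} f g m =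
  foldr _xor_ false
    (concatMap (λ a → map (λ b → f a ∧ g b ∧ ⌊ (a ∪m b) ≟m m ⌋) (allMon k)) (allMon k))

zeroQ : ∀ {k} → PolyQ k
zeroQ _ = 0ℚ

constQ : ∀ {k} → ℚ → PolyQ k
constQ c m = if ⌊ m ≟m emptyMon ⌋ then c else 0ℚ

varQ : ∀ {k} → Fin k → PolyQ k
varQ j m = if ⌊ m ≟m unitMon j ⌋ then 1ℚ else 0ℚ

monoQ : ∀ {k} → Mon k → PolyQ k
monoQ a m = if ⌊ m ≟m a ⌋ then 1ℚ else 0ℚ

_+Q_ : ∀ {k} → PolyQ k → PolyQ k → PolyQ k
(f +Q g) m = f m + g m

_-Q_ : ∀ {k} → PolyQ k → PolyQ k → PolyQ k
(f -Q g) m = f m - g m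

scaleQ : ∀ {k} → ℚ → PolyQ k → PolyQ k
scaleQ c f m = c * f m

_·Q_ : ∀ {k} → PolyQ k → PolyQ k → PolyQ k
_·Q_ {k} f g m =
  foldr _+_ 0ℚ
    (concatMap (λ a → map (λ b → if ⌊ (a ∪m b) ≟m m ⌋ then f a * g b else 0ℚ) (allMon k)) (allMon k))

2ℚ : ℚ
2ℚ = 1ℚ + 1ℚ

-- The map Q ↦ Q̂ : it is multiplicative, sends ⊕ to a + b - 2ab,
-- y_j to y_j, 0 to 0, 1 to 1.  Computed on the normal form of Q
-- (a ⊕-sum of distinct monomials).
hatStep : ∀ {k} → PolyQ k → PolyQ k → PolyQ k
hatStep p q = (p +Q q) -Q scaleQ 2ℚ (p ·Q q)

hat : ∀ {k} → Poly2 k → PolyQ k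
hat {k} f = foldr (λ a acc → if f a then hatStep (monoQ a) acc else acc) zeroQ (allMon k)

NotIn2 : ∀ {k} → Fin k → Poly2 k → Set
NotIn2 j f = ∀ m → lookup m j ≡ true → f m ≡ false

NotInQ : ∀ {k} → Fin k → PolyQ k → Set
NotInQ j f = ∀ m → lookup m j ≡ true → f m ≡ 0ℚ

-- f = f₀ ⊕ y_j f₁ with y_j ∉ Var(f₀, f₁); f[y_j ← Q] = f₀ ⊕ Q f₁
subst2 : ∀ {k} → Fin k → Poly2 k → Poly2 k → Poly2 k
subst2 j Q f = f₀ ⊕ (Q ·2 f₁)
  where
  f₀ f₁ : Poly2 _
  f₀ m = if lookup m j then false else f m
  f₁ m = if lookup m j then false else f (m [ j ]≔ true)

substQ : ∀ {k} → Fin k → PolyQ k → PolyQ k → PolyQ k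
substQ j R f = f₀ +Q (R ·Q f₁)
  where
  f₀ f₁ : PolyQ _
  f₀ m = if lookup m j then 0ℚ else f m
  f₁ m = if lookup m j then 0ℚ else f (m [ j ]≔ true)

remove2 : ∀ {k} → Fin (suc k) → Poly2 (suc k) → Poly2 k
remove2 j f m = f (insertAt m j false)

removeQ : ∀ {k} → Fin (suc k) → PolyQ (suc k) → PolyQ k
removeQ j f m = f (insertAt m j false)

-- Scalars: the real subfield ℚ(√2) = { a + b√2 }, exact representation.

record ℚ√2 : Set where
  constructor _+_√2
  field
    re : ℚ
    ir : ℚ

_*s_ : ℚ√2 → ℚ√2 → ℚ√2
(a + b √2) *s (c + d √2) = ((a * c) + (2ℚ * (b * d))) + ((a * d) + (b * c)) √2

oneS : ℚ√2
oneS = 1ℚ + 0ℚ √2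

twoS : ℚ√2
twoS = 2ℚ + 0ℚ √2

√2S : ℚ√2
√2S = 0ℚ + 1ℚ √2

inv√2S : ℚ√2
inv√2S = 0ℚ + ½ √2

iterS : ℕ → ℚ√2 → ℚ√2
iterS zero    x = oneS
iterS (suc n) x = x *s iterS n x

inv√2^ : ℤ → ℚ√2
inv√2^ (+ n)     = iterS n inv√2S
inv√2^ -[1+ n ]  = iterS (suc n) √2S

-- SOP morphisms n → m
--   s Σ_{y ∈ V^k} e^{2iπ P(y)} |O(y)⟩⟨I(y)|

record SOP (n m : ℕ) : Set where
  constructor sop
  field
    k : ℕ
    s : ℚ√2
    P : PolyQ k
    O : Vec (Poly2 k) m
    I : Vec (Poly2 k) n

IsInt : ℚ → Set
IsInt q = Q.ℚ.denominatorℕ q ≡ 1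

_≈P_ : ∀ {k} → PolyQ k → PolyQ k → Set
P ≈P P' = ∀ m → IsInt (P m - P' m)

_≡2_ : ∀ {k} → Poly2 k → Poly2 k → Set
f ≡2 g = ∀ m → f m ≡ g m

_≡Q_ : ∀ {k} → PolyQ k → PolyQ k → Set
f ≡Q g = ∀ m → f m ≡ g m

pullMon : ∀ {k k'} → (Fin k → Fin k') → Mon k' → Mon k
pullMon σ m' = tabulate (λ i → lookup m' (σ i))

_≈_ : ∀ {n m} → SOP n m → SOP n m → Set
sop k s P O I ≈ sop k' s' P' O' I' =
  Σ (Fin k ↔ Fin k') λ σ →
    let τ = Inverse.to σ in
    (s ≡ s')
    × (∀ m' → IsInt (P' m' - P (pullMon τ m')))
    × (∀ j m' → lookup O' j m' ≡ lookup O j (pullMon τ m'))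
    × (∀ j m' → lookup I' j m' ≡ lookup I j (pullMon τ m'))

substAll : ∀ {k r} → Fin k → Poly2 k → Vec (Poly2 k) r → Vec (Poly2 k) r
substAll j Q = V.map (subst2 j Q)

-- t[y_j ← Q] keeping y_j as summation variable
substSOP : ∀ {n m} (t : SOP n m) → Fin (SOP.k t) → Poly2 (SOP.k t) → SOP n m
substSOP (sop k s P O I) j Q = sop k s (substQ j (hat Q) P) (substAll j Q O) (substAll j Q I)

AllZero2 : ∀ {k r} → Vec (Poly2 k) r → Set
AllZero2 v = ∀ j → lookup v j ≡2 zero2

data Step₀ {n m : ℕ} : SOP n m → SOP n m → Set where
  elim : ∀ {k} (s : ℚ√2) (P : PolyQ (suc k)) O I (y₀ : Fin (suc k)) →
    NotInQ y₀ P → (∀ j → NotIn2 y₀ (lookup O j)) → (∀ j → NotIn2 y₀ (lookup I j)) →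
    Step₀ (sop (suc k) s P O I)
          (sop k (twoS *s s) (removeQ y₀ P) (V.map (remove2 y₀) O) (V.map (remove2 y₀) I))
  hhgen : ∀ {k} (s : ℚ√2) (P : PolyQ (suc k)) O I (y₀ yᵢ : Fin (suc k))
    (Q Q' : Poly2 (suc k)) (R : PolyQ (suc k)) →
    y₀ ≢ yᵢ →
    P ≡Q (scaleQ ½ (varQ y₀ ·Q ((varQ yᵢ ·Q hat Q) +Q (hat Q' +Q constQ 1ℚ))) +Q R) →
    (Q ·2 Q') ≡2 Q' →
    NotIn2 y₀ Q → NotIn2 y₀ Q' → NotInQ y₀ R →
    (∀ j → NotIn2 y₀ (lookup O j)) → (∀ j → NotIn2 y₀ (lookup I j)) →
    NotIn2 yᵢ Q → NotIn2 yᵢ Q' →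
    Step₀ (sop (suc k) s P O I)
          (sop k s (removeQ yᵢ (substQ yᵢ (hat (one2 ⊕ Q')) P))
                   (V.map (remove2 yᵢ) (substAll yᵢ (one2 ⊕ Q') O))
                   (V.map (remove2 yᵢ) (substAll yᵢ (one2 ⊕ Q') I)))
  ket : ∀ {k} (s : ℚ√2) (P : PolyQ k) O I (y₀ : Fin k) (i : Fin m) (O' : Poly2 k) →
    lookup O i ≡2 (var2 y₀ ⊕ O') →
    ¬ (O' ≡2 zero2) →
    NotIn2 y₀ O' →
    (∀ j → toℕ j < toℕ i → NotIn2 y₀ (lookup O j)) →
    Step₀ (sop k s P O I) (substSOP (sop k s P O I) y₀ (lookup O i))
  bra : ∀ {k} (s : ℚ√2) (P : PolyQ k) O I (y₀ : Fin k) (i : Fin n) (I' : Poly2 k) →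
    lookup I i ≡2 (var2 y₀ ⊕ I') →
    ¬ (I' ≡2 zero2) →
    NotIn2 y₀ I' →
    (∀ j → NotIn2 y₀ (lookup O j)) →
    (∀ j → toℕ j < toℕ i → NotIn2 y₀ (lookup I j)) →
    Step₀ (sop k s P O I) (substSOP (sop k s P O I) y₀ (lookup I i))
  zrule : ∀ {k} (s : ℚ√2) (P : PolyQ k) O I (y₀ : Fin k) (R : PolyQ k) →
    P ≡Q (scaleQ ½ (varQ y₀) +Q R) →
    NotInQ y₀ R →
    (∀ j → NotIn2 y₀ (lookup O j)) → (∀ j → NotIn2 y₀ (lookup I j)) →
    (¬ (R ≈P zeroQ) ⊎ ¬ (AllZero2 O × AllZero2 I)) →
    Step₀ (sop k s P O I)
          (sop 1 oneS (scaleQ ½ (varQ Data.Fin.zero)) (replicate _ zero2) (replicate _ zero2))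

-- →_TH on morphisms (i.e. on ≈-classes): rewrite any representative
_⟶TH_ : ∀ {n m} → SOP n m → SOP n m → Set
t ⟶TH u = Σ _ λ t₀ → Σ _ λ u₀ → (t ≈ t₀) × Step₀ t₀ u₀ × (u₀ ≈ u)

Irreducible : ∀ {n m} → SOP n m → Set
Irreducible t = ∀ u → ¬ (t ⟶TH u)

InSOPhalf : ∀ {n m} → SOP n m → Set
InSOPhalf (sop k s P O I) = (∃ λ (p : ℤ) → s ≡ inv√2^ p) × (∀ mo → IsInt (2ℚ * P mo))

{-# OPTIONS --safe #-}
-- The critical pair comes from  t = Σ_{y₀y₁y₂} e^{2iπ(y₀/2 + (y₁/2)(y₂ + 1))}.
-- Rule Z fires on y₀ and collapses t to  Σ_y e^{iπy}.  Rule HHgen instead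
-- fires on (y₁, y₂) with Q = 1, Q' = 0: it sets y₂ ← 1, which turns the y₁
-- term into an integer phase, and Elim then drops y₁ at the cost of a factor 2,
-- giving  2 Σ_y e^{iπy}.  No rule applies to a morphism  s Σ_y e^{iπy}  of type
-- 0 → 0: Elim needs a variable absent from the phase, HHgen two variables, and
-- Z a non-integral remainder next to y/2.  Identification never changes the scalar.
module Submission where

open import Defs
open import Data.Nat using (ℕ) renaming (suc to 1+)
import Data.Nat.Properties as ℕ
open import Data.Integer using (+_)
open import Data.Bool using (true; false)
import Data.Bool.Properties as Bool
open import Data.Fin using (Fin; zero; suc)
open import Data.Vec using ([]; _∷_; lookup)
import Data.Vec as Vec
open import Data.Vec.Properties using (lookup∘update; tabulate∘lookup)
open import Data.List using (map; _++_)
open import Data.List.Membership.Propositional using (_∈_)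
open import Data.List.Membership.Propositional.Properties using (∈-map⁺; ∈-++⁺ˡ; ∈-++⁺ʳ)
open import Data.List.Relation.Unary.All using (all?)
import Data.List.Relation.Unary.All as All
open import Data.List.Relation.Unary.Any using (here)
open import Data.Rational using (0ℚ; 1ℚ; ½; _-_)
import Data.Rational as ℚ
import Data.Rational.Properties as ℚ
open import Data.Product using (Σ; _×_; _,_)
open import Data.Sum using (inj₁; inj₂)
open import Data.Empty using (⊥)
open import Function.Bundles using (_↔_; Inverse)
open import Function.Properties.Inverse using (↔-refl)
open import Relation.Binary.PropositionalEquality
open import Relation.Nullary using (¬_; yes; no)
open import Relation.Nullary.Decidable using (True; toWitness; _→-dec_)
open import Relation.Unary using (Decidable)
open import Relation.Binary.Construct.Closure.ReflexiveTransitive using (Star; ε; _◅_)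

allMon-complete : ∀ {k} (m : Mon k) → m ∈ allMon k
allMon-complete []          = here refl
allMon-complete (false ∷ m) = ∈-++⁺ˡ (∈-map⁺ (false ∷_) (allMon-complete m))
allMon-complete (true ∷ m)  =
  ∈-++⁺ʳ (map (false ∷_) (allMon _)) (∈-map⁺ (true ∷_) (allMon-complete m))

∀-mon-by-evaluation : ∀ {k} {P : Mon k → Set} (P? : Decidable P) →
                      True (all? P? (allMon k)) → ∀ m → P m
∀-mon-by-evaluation P? checked m = All.lookup (toWitness checked) (allMon-complete m)

integral? : ∀ {k} (f : PolyQ k) → Decidable (λ m → IsInt (f m))
integral? f m = ℚ.ℚ.denominatorℕ (f m) ℕ.≟ 1

absent2? : ∀ {k} (j : Fin k) (f : Poly2 k) → Decidable (λ m → lookup m j ≡ true → f m ≡ false)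
absent2? j f m = (lookup m j Bool.≟ true) →-dec (f m Bool.≟ false)

absentQ? : ∀ {k} (j : Fin k) (f : PolyQ k) → Decidable (λ m → lookup m j ≡ true → f m ≡ 0ℚ)
absentQ? j f m = (lookup m j Bool.≟ true) →-dec (f m ℚ.≟ 0ℚ)

lookup-unitMon : ∀ {k} (j : Fin k) → lookup (unitMon {k} j) j ≡ true
lookup-unitMon {k} j = lookup∘update j (Vec.replicate k false) true

varQ-absent : ∀ {k} (j : Fin k) (m : Mon k) → lookup m j ≡ false → varQ j m ≡ 0ℚ
varQ-absent j m j∉m with m ≟m unitMon j
... | no _ = refl
... | yes refl with trans (sym (lookup-unitMon j)) j∉m
...   | ()

↔-from-Fin1-hits : ∀ {k} (σ : Fin 1 ↔ Fin k) (y : Fin k) → Inverse.to σ zero ≡ y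
↔-from-Fin1-hits σ y with Inverse.from σ y | Inverse.strictlyInverseˡ σ y
... | zero | σσ⁻¹y≡y = σσ⁻¹y≡y

pullMon-unitMon : ∀ {k} (σ : Fin 1 ↔ Fin k) (y : Fin k) →
                  pullMon (Inverse.to σ) (unitMon y) ≡ true ∷ []
pullMon-unitMon σ y =
  cong (_∷ []) (trans (cong (lookup (unitMon y)) (↔-from-Fin1-hits σ y)) (lookup-unitMon y))

≈-by-phase : ∀ {n m} (t : SOP n m) (P' : PolyQ (SOP.k t)) →
             (∀ mo → IsInt (P' mo - SOP.P t mo)) → t ≈ record t { P = P' }
≈-by-phase (sop k s P O I) P' P'-P∈ℤ =
  ↔-refl , refl , phase , (λ j mo → cong (lookup O j) (pull-id mo))
                        , (λ j mo → cong (lookup I j) (pull-id mo))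
  where
  pull-id : ∀ mo → mo ≡ pullMon (Inverse.to ↔-refl) mo
  pull-id mo = sym (tabulate∘lookup mo)
  phase : ∀ mo → IsInt (P' mo - P (pullMon (Inverse.to ↔-refl) mo))
  phase mo = subst (λ x → IsInt (P' mo - P x)) (pull-id mo) (P'-P∈ℤ mo)

≈-refl : ∀ {n m} (t : SOP n m) → t ≈ t
≈-refl t@(sop _ _ P _ _) = ≈-by-phase t P (λ mo → subst IsInt (sym (ℚ.+-inverseʳ (P mo))) refl)

halfPhase : ∀ {k} → PolyQ (1+ k)
halfPhase = scaleQ ½ (varQ zero)

signSum : ℚ√2 → SOP 0 0
signSum s = sop 1 s halfPhase [] []

signSum-injective : ∀ {s s'} → signSum s ≈ signSum s' → s ≡ s'
signSum-injective (_ , s≡s' , _) = s≡s'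

no-step-from-signSum : ∀ {s t₀ u₀} → signSum s ≈ t₀ → Step₀ t₀ u₀ → ⊥
no-step-from-signSum (σ , _ , phase , _) (elim _ P _ _ y₀ y₀∉P _ _) =
  half∉ℤ (subst₂ (λ a b → IsInt (a - halfPhase b))
                 (y₀∉P _ (lookup-unitMon y₀)) (pullMon-unitMon σ y₀) (phase (unitMon y₀)))
  where
  half∉ℤ : ¬ IsInt (0ℚ - ½)
  half∉ℤ ()
no-step-from-signSum (σ , _) (hhgen _ _ _ _ y₀ yᵢ _ _ _ y₀≢yᵢ _ _ _ _ _ _ _ _ _) =
  y₀≢yᵢ (trans (sym (↔-from-Fin1-hits σ y₀)) (↔-from-Fin1-hits σ yᵢ))
no-step-from-signSum _ (ket _ _ _ _ _ () _ _ _ _ _)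
no-step-from-signSum _ (bra _ _ _ _ _ () _ _ _ _ _ _)
no-step-from-signSum _ (zrule _ _ _ _ _ _ _ _ _ _ (inj₂ not-all-zero)) =
  not-all-zero ((λ ()) , (λ ()))
no-step-from-signSum (σ , _ , phase , _) (zrule _ P _ _ y₀ R P≡ y₀∉R _ _ (inj₁ R≉0)) =
  R≉0 R∈ℤ
  where
  -- Off y₀ the phase P is R, and it is matched with the zero phase of signSum.
  R∈ℤ : R ≈P zeroQ
  R∈ℤ mo with lookup mo y₀ in y₀∈mo
  ... | true rewrite y₀∉R mo y₀∈mo = refl
  ... | false = subst IsInt P-half≡R (phase mo)
    where
    P-half≡R : P mo - halfPhase (pullMon (Inverse.to σ) mo) ≡ R mo - 0ℚ
    P-half≡R rewrite P≡ mo | varQ-absent y₀ mo y₀∈mo | ↔-from-Fin1-hits σ y₀ | y₀∈mo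
                   | ℚ.+-identityˡ (R mo) = refl

signSum-irreducible : ∀ s → Irreducible (signSum s)
signSum-irreducible s _ (_ , _ , t≈t₀ , step , _) = no-step-from-signSum t≈t₀ step

y₀ y₁ y₂ : Fin 3
y₀ = zero
y₁ = suc zero
y₂ = suc (suc zero)

hhPhase zPhase : PolyQ 3
hhPhase = scaleQ ½ (varQ y₁ ·Q ((varQ y₂ ·Q hat one2) +Q (hat zero2 +Q constQ 1ℚ)))
zPhase  = scaleQ ½ (varQ y₀)

criticalPhase : PolyQ 3
criticalPhase = zPhase +Q hhPhase

critical : SOP 0 0
critical = sop 3 oneS criticalPhase [] []

critical∈SOP½ : InSOPhalf critical
critical∈SOP½ = (+ 0 , refl) , ∀-mon-by-evaluation (integral? (scaleQ 2ℚ criticalPhase)) _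

critical⟶Z : critical ⟶TH signSum oneS
critical⟶Z = critical , signSum oneS , ≈-refl critical ,
  zrule oneS _ [] [] y₀ hhPhase (λ _ → refl)
        (∀-mon-by-evaluation (absentQ? y₀ hhPhase) _) (λ ()) (λ ()) (inj₁ hh≉0) ,
  ≈-refl (signSum oneS)
  where
  hh≉0 : ¬ (hhPhase ≈P zeroQ)
  hh≉0 hh≈0 with hh≈0 (false ∷ true ∷ false ∷ [])
  ... | ()

afterHHPhase : PolyQ 2
afterHHPhase = removeQ y₂ (substQ y₂ (hat (one2 ⊕ zero2)) criticalPhase)

afterHH : SOP 0 0
afterHH = sop 2 oneS afterHHPhase [] []

critical⟶HH : critical ⟶TH afterHH
critical⟶HH = critical , afterHH , ≈-refl critical ,
  hhgen oneS _ [] [] y₁ y₂ one2 zero2 zPhase (λ ())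
        (λ mo → ℚ.+-comm (zPhase mo) (hhPhase mo))
        (∀-mon-by-evaluation (λ mo → _ Bool.≟ _) _)
        (∀-mon-by-evaluation (absent2? y₁ one2) _) (λ _ _ → refl)
        (∀-mon-by-evaluation (absentQ? y₁ zPhase) _) (λ ()) (λ ())
        (∀-mon-by-evaluation (absent2? y₂ one2) _) (λ _ _ → refl) ,
  ≈-refl afterHH

afterHH⟶Elim : afterHH ⟶TH signSum twoS
afterHH⟶Elim = cleaned , _ ,
  ≈-by-phase afterHH halfPhase (∀-mon-by-evaluation (integral? (halfPhase -Q afterHHPhase)) _) ,
  elim oneS halfPhase [] [] (suc zero)
       (∀-mon-by-evaluation (absentQ? (suc zero) halfPhase) _) (λ ()) (λ ()) ,
  ≈-by-phase (sop 1 twoS (removeQ (suc zero) halfPhase) [] []) halfPhase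
             (∀-mon-by-evaluation (integral? (halfPhase -Q removeQ (suc zero) halfPhase)) _)
  where
  -- After y₂ ← 1 the y₁ term y₁ (1 + 0 + 1)/2 = y₁ is an integer phase.
  cleaned : SOP 0 0
  cleaned = sop 2 oneS halfPhase [] []

lemma5p4 : Σ ℕ λ n → Σ ℕ λ m → Σ (SOP n m) λ t → Σ (SOP n m) λ t' → Σ (SOP n m) λ t'' →
    InSOPhalf t × Star _⟶TH_ t t' × Star _⟶TH_ t t''
      × Irreducible t' × Irreducible t'' × ¬ (t' ≈ t'')
lemma5p4 = 0 , 0 , critical , signSum oneS , signSum twoS ,
  critical∈SOP½ ,
  critical⟶Z ◅ ε ,
  _◅_ {j = afterHH} critical⟶HH (afterHH⟶Elim ◅ ε) ,
  signSum-irreducible oneS ,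
  signSum-irreducible twoS ,
  λ same → one≢two (signSum-injective same)
  where
  one≢two : oneS ≢ twoS
  one≢two ()
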